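{- Let $p,q$ be integers with $1<p<q$ and $\gcd(p,q)=1$, and let $N\in\mathbb{N}$. Then the maximal cardinality of a $\{p,q\}$-quotient-free subset of $\{1,2,\ldots,N\}$ equals $$\sum_{\substack{n\le N,\\ p\nmid n,\ q\nmid n}}\max\big(|A_0(t(N/n))|,|A_1(t(N/n))|\big).$$
   Context: A set $S$ of positive integers is $\{p,q\}$-quotient-free if there are no $x,y\in S$ with $x/y\in\{p,q\}$. Let $m_1<m_2<\cdots$ be the increasing enumeration of all integers of the form $p^xq^y$ with $x,y\in\mathbb{Z}_{\ge0}$, where $m_i=p^{x_i}q^{y_i}$ (so $m_1=1$). For $j\in\{0,1\}$ and $t\ge1$ let $A_j(t)=\{m_i:1\le i\le t,\ x_i+y_i\equiv j\pmod 2\}$. For real $u\ge1$, $t(u)$ is the integer defined by $m_{t(u)}\le u<m_{t(u)+1}$. -}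

module Defs where

open import Data.Nat using (ℕ; zero; suc; _+_; _*_; _^_; _≤_; _<_; _%_; _/_; _⊔_)
open import Data.Nat.Divisibility using (_∣_; _∣?_)
open import Data.Bool using (Bool; true; false; _∧_; _∨_; not; if_then_else_)
open import Data.List using (List; []; _∷_; length; map; upTo; applyUpTo)
open import Data.Nat.ListAction using (sum)
open import Data.Bool.ListAction using (any)
open import Data.List.Membership.Propositional using (_∈_)
open import Data.List.Relation.Unary.All using (All)
open import Data.List.Relation.Unary.Unique.Propositional using (Unique)
open import Data.Product using (_×_; Σ; ∃; ∃-syntax)
open import Relation.Binary.PropositionalEquality using (_≡_; _≢_)
open import Relation.Nullary.Negation using (¬_)
open import Relation.Nullary.Decidable using (⌊_⌋)
import Data.Nat as ℕ

range1 : ℕ → List ℕ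
range1 M = applyUpTo suc M

-- {p,q}-quotient-free finite sets of positive integers, as duplicate-free
-- lists.  x / y ∈ {p,q} (y > 0) means x ≡ p * y or x ≡ q * y.

QuotientFree : ℕ → ℕ → List ℕ → Set
QuotientFree p q S =
  ∀ {x y} → x ∈ S → y ∈ S → (x ≢ p * y) × (x ≢ q * y)

AdmissibleSubset : ℕ → ℕ → ℕ → List ℕ → Set
AdmissibleSubset p q N S =
  Unique S × All (λ x → 1 ≤ x × x ≤ N) S × QuotientFree p q S

IsMaxQFCard : ℕ → ℕ → ℕ → ℕ → Set
IsMaxQFCard p q N K =
  (∃[ S ] (AdmissibleSubset p q N S × length S ≡ K))
  × (∀ S → AdmissibleSubset p q N S → length S ≤ K)

-- The sets A_j(t(u)).  {m_i : i ≤ t(u)} is exactly the set of integers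
-- p^x q^y with p^x q^y ≤ u, so A_j(t(u)) is the set of integers
-- m ≤ u (equivalently m ≤ ⌊u⌋) of the form p^x q^y with x + y ≡ j (mod 2).
-- (Paper-level predicate:)
InA : ℕ → ℕ → ℕ → ℕ → Set
InA p q j m = ∃[ x ] ∃[ y ] (m ≡ p ^ x * q ^ y × (x + y) % 2 ≡ j % 2)

-- Boolean decision of InA, searching exponents x, y ≤ m.  For p, q ≥ 2
-- this search is exhaustive, since p ^ x * q ^ y ≥ 2 ^ x > x (same for y).
inAᵇ : ℕ → ℕ → ℕ → ℕ → Bool
inAᵇ p q j m =
  any (λ x → any (λ y → (p ^ x * q ^ y ℕ.≡ᵇ m) ∧ ((x + y) % 2 ℕ.≡ᵇ j % 2))
                 (upTo (suc m)))
      (upTo (suc m))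

countᵇ : (ℕ → Bool) → List ℕ → ℕ
countᵇ f xs = sum (map (λ m → if f m then 1 else 0) xs)

-- |A_j(t(u))| for u = N / n with integers N, n ≥ 1: only ⌊N/n⌋ matters.
cardA : ℕ → ℕ → ℕ → (N n : ℕ) → ℕ
cardA p q j N zero    = 0
cardA p q j N (suc k) = countᵇ (inAᵇ p q j) (range1 (N / suc k))

summand : ℕ → ℕ → ℕ → ℕ → ℕ
summand p q N n =
  if not ⌊ p ∣? n ⌋ ∧ not ⌊ q ∣? n ⌋
  then cardA p q 0 N n ⊔ cardA p q 1 N n
  else 0

formula : ℕ → ℕ → ℕ → ℕ
formula p q N = sum (map (summand p q N) (range1 N))

module Submission where

-- Every m ≥ 1 factors uniquely as m = n · p^x · q^y with p ∤ n and q ∤ n; the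
-- numbers with a fixed core n and n · p^x · q^y ≤ N form a chain whose exponent
-- pairs (x , y) are the cells of the Young diagram {(x , y) : p^x q^y ≤ N / n}.
-- Inside a chain, m' = p m or m' = q m exactly when the cell of m' lies directly
-- right of or above the cell of m, so a quotient-free set meets each chain in an
-- independent set of cells.  Colouring cells by the parity of x + y, A_0 and A_1
-- are the two colour classes of the diagram, and the formula is the sum over
-- cores of the larger class.

open import Defs
open import Data.Nat using (ℕ; _<_)
open import Data.Nat.GCD using (gcd)
open import Relation.Binary.PropositionalEquality using (_≡_)

open import Data.Bool using (Bool; true; false; not; T; if_then_else_)
open import Data.Bool.Properties using (not-involutive; not-¬; ¬-not; T-∧) renaming (_≟_ to _≟ᵇ_)
open import Data.Empty using (⊥; ⊥-elim)
open import Data.List using (List; []; _∷_; _++_; map; length; filter; downFrom; upTo; applyUpTo)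
open import Data.List.Membership.Propositional using (_∈_; lose; find)
open import Data.List.Membership.Propositional.Properties
  using (∈-map⁺; ∈-map⁻; ∈-filter⁺; ∈-filter⁻; ∈-++⁺ˡ; ∈-++⁺ʳ; ∈-++⁻; ∈-downFrom⁺; ∈-downFrom⁻;
         ∈-upTo⁺; ∈-applyUpTo⁺; ∈-applyUpTo⁻)
open import Data.List.Membership.Propositional.Properties.WithK using (unique∧set⇒bag)
open import Data.List.Properties using (length-map; length-++; filter-++; filter-accept; filter-reject; filter-none)
open import Data.List.Relation.Binary.BagAndSetEquality using (∼bag⇒↭)
open import Data.List.Relation.Binary.Permutation.Propositional using (_↭_; ↭-sym; ↭-trans; ↭-swap; ↭-prep; ↭-refl)
open import Data.List.Relation.Binary.Permutation.Propositional.Properties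
  using (↭-length; filter-↭; ∈-resp-↭; ++⁺ˡ; map⁺; shift; shifts)
open import Data.List.Relation.Unary.All as All using (All; []; _∷_)
open import Data.List.Relation.Unary.Any using (here; there)
open import Data.List.Relation.Unary.Any.Properties using (any⁺; any⁻)
open import Data.List.Relation.Unary.Unique.Propositional using (Unique; []; _∷_)
import Data.List.Relation.Unary.Unique.Propositional.Properties as Unique
open import Data.Nat using (zero; suc; _+_; _*_; _∸_; _^_; _≤_; _⊔_; _%_; _/_; z≤n; s≤s; z<s; _<?_; _≤?_; NonZero; >-nonZero)
open import Data.Nat.Coprimality using (Coprime; coprime-divisor; gcd≡1⇒coprime)
open import Data.Nat.Divisibility using (_∣_; _∣?_; divides; ∣-trans; n∣m*n; ∣1⇒≡1)
open import Data.Nat.DivMod using ([m+n]%n≡m%n; m*n/n≡m; /-monoˡ-≤; m/n*n≤m)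
open import Data.Nat.Induction using (Acc; acc; <-wellFounded; <-rec)
open import Data.Nat.ListAction using (sum)
open import Data.Nat.Properties
open import Algebra.Properties.CommutativeSemigroup +-commutativeSemigroup using (interchange)
open import Data.Nat.Tactic.RingSolver using (solve-∀)
open import Data.Product using (_×_; _,_; proj₁; proj₂; ∃; map₂)
open import Data.Sum using (_⊎_; inj₁; inj₂)
open import Function using (_∘_; Equivalence)
open import Function.Bundles using (mk⇔)
open import Relation.Binary.PropositionalEquality
open import Relation.Nullary using (¬_; Dec; yes; no; ¬?; _×-dec_)
open import Relation.Nullary.Decidable using (T?)
open import Relation.Unary using (Decidable)

count : {A : Set} {P : A → Set} → Decidable P → List A → ℕ
count P? xs = length (filter P? xs)

↭-fromMembers : {A : Set} {xs ys : List A} → Unique xs → Unique ys →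
  (∀ {z} → z ∈ xs → z ∈ ys) → (∀ {z} → z ∈ ys → z ∈ xs) → xs ↭ ys
↭-fromMembers uxs uys to from = ∼bag⇒↭ (unique∧set⇒bag uxs uys (mk⇔ to from))

count-↭ : {A : Set} {P : A → Set} (P? : Decidable P) {xs ys : List A} →
  xs ↭ ys → count P? xs ≡ count P? ys
count-↭ P? xs↭ys = ↭-length (filter-↭ P? xs↭ys)

length-≡-count+count : {A : Set} {P : A → Set} (P? : Decidable P) (xs : List A) →
  length xs ≡ count P? xs + count (¬? ∘ P?) xs
length-≡-count+count P? [] = refl
length-≡-count+count P? (x ∷ xs) with P? x
... | yes _ = cong suc (length-≡-count+count P? xs)
... | no _  = trans (cong suc (length-≡-count+count P? xs)) (sym (+-suc _ _))

unique-map-on : {A B : Set} (f : A → B) {xs : List A} →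
  (∀ {x y} → x ∈ xs → y ∈ xs → f x ≡ f y → x ≡ y) → Unique xs → Unique (map f xs)
unique-map-on f inj [] = []
unique-map-on f inj (x∉xs ∷ uxs) =
  All.tabulate fresh ∷ unique-map-on f (λ x∈ y∈ → inj (there x∈) (there y∈)) uxs
  where
  fresh : ∀ {w} → w ∈ map f _ → f _ ≢ w
  fresh w∈ e with ∈-map⁻ f w∈
  ... | z , z∈ , refl = All.lookup x∉xs z∈ (inj (here refl) (there z∈) e)

count-bijection : {A B : Set} {P : A → Set} {Q : B → Set} (P? : Decidable P) (Q? : Decidable Q)
  (g : A → B) {xs : List A} {ys : List B} → Unique xs → Unique ys →
  (∀ {x} → x ∈ xs → P x → g x ∈ ys × Q (g x)) →
  (∀ {x x'} → x ∈ xs → x' ∈ xs → P x → P x' → g x ≡ g x' → x ≡ x') →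
  (∀ {y} → y ∈ ys → Q y → ∃ λ x → x ∈ xs × P x × g x ≡ y) →
  count P? xs ≡ count Q? ys
count-bijection P? Q? g {xs} {ys} uxs uys maps-to injective onto =
  trans (sym (length-map g (filter P? xs))) (↭-length (↭-fromMembers
    (unique-map-on g injective′ (Unique.filter⁺ P? uxs)) (Unique.filter⁺ Q? uys) forth back))
  where
  injective′ : ∀ {x x'} → x ∈ filter P? xs → x' ∈ filter P? xs → g x ≡ g x' → x ≡ x'
  injective′ x∈ x'∈ with ∈-filter⁻ P? {xs = xs} x∈ | ∈-filter⁻ P? {xs = xs} x'∈
  ... | x∈xs , px | x'∈xs , px' = injective x∈xs x'∈xs px px'
  forth : ∀ {y} → y ∈ map g (filter P? xs) → y ∈ filter Q? ys
  forth y∈ with ∈-map⁻ g y∈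
  ... | x , x∈ , refl with ∈-filter⁻ P? {xs = xs} x∈
  ... | x∈xs , px = let (gx∈ , qgx) = maps-to x∈xs px in ∈-filter⁺ Q? gx∈ qgx
  back : ∀ {y} → y ∈ filter Q? ys → y ∈ map g (filter P? xs)
  back y∈ with ∈-filter⁻ Q? {xs = ys} y∈
  ... | y∈ys , qy with onto y∈ys qy
  ... | x , x∈xs , px , refl = ∈-map⁺ g (∈-filter⁺ P? x∈xs px)

count-map : {A B : Set} {P : B → Set} {Q : A → Set} (P? : Decidable P) (Q? : Decidable Q)
  (f : A → B) → (∀ x → P (f x) → Q x) → (∀ x → Q x → P (f x)) →
  ∀ xs → count P? (map f xs) ≡ count Q? xs
count-map P? Q? f to from [] = refl
count-map P? Q? f to from (x ∷ xs) with P? (f x) | Q? x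
... | yes _   | yes _  = cong suc (count-map P? Q? f to from xs)
... | no _    | no _   = count-map P? Q? f to from xs
... | yes pfx | no ¬qx = ⊥-elim (¬qx (to x pfx))
... | no ¬pfx | yes qx = ⊥-elim (¬pfx (from x qx))

sum-cong : {A : Set} (f g : A → ℕ) (xs : List A) →
  (∀ {x} → x ∈ xs → f x ≡ g x) → sum (map f xs) ≡ sum (map g xs)
sum-cong f g [] eq = refl
sum-cong f g (x ∷ xs) eq = cong₂ _+_ (eq (here refl)) (sum-cong f g xs (eq ∘ there))

sum-mono : {A : Set} (f g : A → ℕ) (xs : List A) →
  (∀ {x} → x ∈ xs → f x ≤ g x) → sum (map f xs) ≤ sum (map g xs)
sum-mono f g [] le = z≤n
sum-mono f g (x ∷ xs) le = +-mono-≤ (le (here refl)) (sum-mono f g xs (le ∘ there))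

count-accept : {A : Set} {P : A → Set} (P? : Decidable P) {x : A} {xs : List A} →
  P x → count P? (x ∷ xs) ≡ suc (count P? xs)
count-accept P? px = cong length (filter-accept P? px)

count-reject : {A : Set} {P : A → Set} (P? : Decidable P) {x : A} {xs : List A} →
  ¬ P x → count P? (x ∷ xs) ≡ count P? xs
count-reject P? ¬px = cong length (filter-reject P? ¬px)

count-++ : {A : Set} {P : A → Set} (P? : Decidable P) (xs ys : List A) →
  count P? (xs ++ ys) ≡ count P? xs + count P? ys
count-++ P? xs ys = trans (cong length (filter-++ P? xs ys)) (length-++ (filter P? xs))

count-unique : (v : ℕ) {R : List ℕ} → Unique R → v ∈ R → count (v ≟_) R ≡ 1
count-unique v (v∉R ∷ _) (here refl) =
  trans (count-accept (v ≟_) refl) (cong (suc ∘ length) (filter-none (v ≟_) v∉R))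
count-unique v (r∉R ∷ uR) (there v∈) =
  trans (count-reject (v ≟_) (λ { refl → All.lookup r∉R v∈ refl })) (count-unique v uR v∈)

sum-fibres : {A : Set} (f : A → ℕ) {R : List ℕ} → Unique R → ∀ xs →
  All (λ x → f x ∈ R) xs → sum (map (λ n → count (λ x → f x ≟ n) xs) R) ≡ length xs
sum-fibres f {R} uR [] [] = zeros R
  where
  zeros : ∀ R → sum (map (λ _ → 0) R) ≡ 0
  zeros [] = refl
  zeros (_ ∷ R) = zeros R
sum-fibres f {R} uR (x ∷ xs) (fx∈R ∷ rest) = begin
  sum (map (fibre (x ∷ xs)) R)                ≡⟨ split R ⟩
  count (f x ≟_) R + sum (map (fibre xs) R)   ≡⟨ cong₂ _+_ (count-unique (f x) uR fx∈R) (sum-fibres f uR xs rest) ⟩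
  suc (length xs)                             ∎
  where
  open ≡-Reasoning
  fibre : List _ → ℕ → ℕ
  fibre ys n = count (λ y → f y ≟ n) ys
  hit : ∀ n → fibre (x ∷ xs) n ≡ count (f x ≟_) (n ∷ []) + fibre xs n
  hit n = by-cases (f x ≟ n)
    where
    by-cases : Dec (f x ≡ n) → fibre (x ∷ xs) n ≡ count (f x ≟_) (n ∷ []) + fibre xs n
    by-cases (yes fx≡n) = trans (count-accept (λ y → f y ≟ n) fx≡n)
      (cong (_+ fibre xs n) (sym (count-accept (f x ≟_) {xs = []} fx≡n)))
    by-cases (no fx≢n)  = trans (count-reject (λ y → f y ≟ n) fx≢n)
      (cong (_+ fibre xs n) (sym (count-reject (f x ≟_) {xs = []} fx≢n)))
  split : ∀ R → sum (map (fibre (x ∷ xs)) R) ≡ count (f x ≟_) R + sum (map (fibre xs) R)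
  split []      = refl
  split (n ∷ R) = begin
    fibre (x ∷ xs) n + sum (map (fibre (x ∷ xs)) R)
      ≡⟨ cong₂ _+_ (hit n) (split R) ⟩
    (count (f x ≟_) (n ∷ []) + fibre xs n) + (count (f x ≟_) R + sum (map (fibre xs) R))
      ≡⟨ interchange (count (f x ≟_) (n ∷ [])) (fibre xs n) (count (f x ≟_) R) _ ⟩
    (count (f x ≟_) (n ∷ []) + count (f x ≟_) R) + (fibre xs n + sum (map (fibre xs) R))
      ≡⟨ cong (_+ (fibre xs n + sum (map (fibre xs) R))) (sym (count-++ (f x ≟_) (n ∷ []) R)) ⟩
    count (f x ≟_) (n ∷ R) + (fibre xs n + sum (map (fibre xs) R)) ∎

≤-from-below : ∀ m n → (∀ x → x < m → x < n) → m ≤ n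
≤-from-below zero    n _     = z≤n
≤-from-below (suc m) n below = below m ≤-refl

-- A cell (x , y) sits in column x of row y.
Cell : Set
Cell = ℕ × ℕ

-- A diagram is the list of its row lengths, bottom row first; rows beyond the list are empty.
row : List ℕ → ℕ → ℕ
row []      _       = 0
row (r ∷ _) zero    = r
row (_ ∷ l) (suc y) = row l y

_∋_ : List ℕ → Cell → Set
l ∋ (x , y) = x < row l y

_∋?_ : (l : List ℕ) → Decidable (l ∋_)
l ∋? (x , y) = x <? row l y

Young : List ℕ → Set
Young l = ∀ y → row l (suc y) ≤ row l y

young-∷ : ∀ {r l} → row l 0 ≤ r → Young l → Young (r ∷ l)
young-∷ l₀≤r young-l zero    = l₀≤r
young-∷ l₀≤r young-l (suc y) = young-l y

up : Cell → Cell
up (x , y) = x , suc y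

bottomRow : ℕ → List Cell
bottomRow r = map (_, 0) (downFrom r)

cells : List ℕ → List Cell
cells []      = []
cells (r ∷ l) = bottomRow r ++ map up (cells l)

∈-cells⁻ : ∀ l {z} → z ∈ cells l → l ∋ z
∈-cells⁻ (r ∷ l) z∈ with ∈-++⁻ (bottomRow r) z∈
... | inj₁ z∈row with ∈-map⁻ (_, 0) z∈row
...   | x , x∈ , refl = ∈-downFrom⁻ x∈
∈-cells⁻ (r ∷ l) z∈ | inj₂ z∈up with ∈-map⁻ up z∈up
...   | w , w∈ , refl = ∈-cells⁻ l w∈

∈-cells⁺ : ∀ l {z} → l ∋ z → z ∈ cells l
∈-cells⁺ (r ∷ l) {x , zero}  x<r = ∈-++⁺ˡ (∈-map⁺ (_, 0) (∈-downFrom⁺ x<r))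
∈-cells⁺ (r ∷ l) {x , suc y} z∈l = ∈-++⁺ʳ (bottomRow r) (∈-map⁺ up (∈-cells⁺ l {x , y} z∈l))

up-injective : ∀ {a b} → up a ≡ up b → a ≡ b
up-injective {x , y} {.x , .y} refl = refl

cells-unique : ∀ l → Unique (cells l)
cells-unique []      = []
cells-unique (r ∷ l) =
  Unique.++⁺ (Unique.map⁺ (cong proj₁) (Unique.downFrom⁺ r)) (Unique.map⁺ up-injective (cells-unique l)) disjoint
  where
  disjoint : ∀ {v} → ¬ (v ∈ bottomRow r × v ∈ map up (cells l))
  disjoint (v∈row , v∈up) with ∈-map⁻ (_, 0) v∈row | ∈-map⁻ up v∈up
  ... | _ , _ , refl | _ , _ , ()

cells-rows : ∀ l l' → (∀ y → row l y ≡ row l' y) → cells l ↭ cells l'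
cells-rows l l' same = ↭-fromMembers (cells-unique l) (cells-unique l')
  (λ {z} z∈ → ∈-cells⁺ l' (subst (proj₁ z <_) (same (proj₂ z)) (∈-cells⁻ l z∈)))
  (λ {z} z∈ → ∈-cells⁺ l (subst (proj₁ z <_) (sym (same (proj₂ z))) (∈-cells⁻ l' z∈)))

row-mono : ∀ l l' → (∀ {z} → z ∈ cells l' → z ∈ cells l) → ∀ y → row l' y ≤ row l y
row-mono l l' sub y = ≤-from-below (row l' y) (row l y) (λ x x< → ∈-cells⁻ l (sub (∈-cells⁺ l' {x , y} x<)))

-- Chessboard colouring: a cell is coloured by the parity of x + y (added as y + x,
-- so that moving a cell up flips its colour by computation).
odd : ℕ → Bool
odd zero    = false
odd (suc n) = not (odd n)

colour : Cell → Bool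
colour (x , y) = odd (y + x)

#colour : Bool → List Cell → ℕ
#colour b = count (λ z → colour z ≟ᵇ b)

colourCount : Bool → List ℕ → ℕ
colourCount b l = #colour b (cells l)

majority : List ℕ → ℕ
majority l = colourCount false l ⊔ colourCount true l

majority-by : ∀ b l → majority l ≡ colourCount b l ⊔ colourCount (not b) l
majority-by false l = refl
majority-by true  l = ⊔-comm (colourCount false l) (colourCount true l)

majority-colour : ∀ b l → colourCount (not b) l ≤ colourCount b l → majority l ≡ colourCount b l
majority-colour b l ≤b = trans (majority-by b l) (m≥n⇒m⊔n≡m ≤b)

majorityColour : List ℕ → Bool
majorityColour l with colourCount true l ≤? colourCount false l
... | yes _ = false
... | no _  = true

majorityColour-count : ∀ l → colourCount (majorityColour l) l ≡ majority l
majorityColour-count l with colourCount true l ≤? colourCount false l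
... | yes t≤f = sym (m≥n⇒m⊔n≡m t≤f)
... | no t≰f  = sym (m≤n⇒m⊔n≡n (<⇒≤ (≰⇒> t≰f)))

#colour-here : ∀ z L → #colour (colour z) (z ∷ L) ≡ suc (#colour (colour z) L)
#colour-here z L = count-accept (λ w → colour w ≟ᵇ colour z) {z} {L} refl

#colour-there : ∀ z L → #colour (not (colour z)) (z ∷ L) ≡ #colour (not (colour z)) L
#colour-there z L = count-reject (λ w → colour w ≟ᵇ not (colour z)) {z} {L} (not-¬ refl)

#colour-up : ∀ b L → #colour b (map up L) ≡ #colour (not b) L
#colour-up b = count-map (λ z → colour z ≟ᵇ b) (λ z → colour z ≟ᵇ not b) up
  (λ z e → trans (sym (not-involutive (colour z))) (cong not e))
  (λ z e → trans (cong not e) (not-involutive b))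

-- The rows above the bottom row are shifted up one step, which swaps their colours.
colourCount-∷ : ∀ b r l → colourCount b (r ∷ l) ≡ #colour b (bottomRow r) + colourCount (not b) l
colourCount-∷ b r l = trans (count-++ _ (bottomRow r) (map up (cells l)))
  (cong (#colour b (bottomRow r) +_) (#colour-up b (cells l)))

Adjacent : Cell → Cell → Set
Adjacent (x , y) b = b ≡ (suc x , y) ⊎ b ≡ (x , suc y)

Independent : List Cell → Set
Independent T = ∀ {a b} → a ∈ T → b ∈ T → ¬ Adjacent a b

independent-⊆ : ∀ {T T'} → (∀ {z} → z ∈ T' → z ∈ T) → Independent T → Independent T'
independent-⊆ T'⊆T indT a∈ b∈ = indT (T'⊆T a∈) (T'⊆T b∈)

adjacent-colour : ∀ a b → Adjacent a b → colour b ≡ not (colour a)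
adjacent-colour (x , y) _ (inj₁ refl) = cong odd (+-suc y x)
adjacent-colour (x , y) _ (inj₂ refl) = refl

adjacent-up : ∀ a b → Adjacent a b → Adjacent (up a) (up b)
adjacent-up (x , y) _ (inj₁ refl) = inj₁ refl
adjacent-up (x , y) _ (inj₂ refl) = inj₂ refl

#colour-pair : ∀ b c c' L → colour c' ≡ not (colour c) → #colour b (c ∷ c' ∷ L) ≡ suc (#colour b L)
#colour-pair b c c' L opposite with b ≟ᵇ colour c
... | yes refl = trans (#colour-here c (c' ∷ L))
  (cong suc (count-reject (λ w → colour w ≟ᵇ colour c) {c'} {L} (λ e → not-¬ refl (trans (sym e) opposite))))
... | no b≢c = trans (count-reject (λ w → colour w ≟ᵇ b) {c} {c' ∷ L} (b≢c ∘ sym))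
  (count-accept (λ w → colour w ≟ᵇ b) {c'} {L} (trans opposite (sym (¬-not b≢c))))

at-most-one : ∀ K T → (∀ {a b} → a ∈ K → b ∈ K → a ≢ b → Adjacent a b ⊎ Adjacent b a) →
  Unique T → Independent T → All (_∈ K) T → length T ≤ 1
at-most-one K []          clique uT           ind all                 = z≤n
at-most-one K (_ ∷ [])    clique uT           ind all                 = s≤s z≤n
at-most-one K (a ∷ b ∷ T) clique ((a≢b ∷ _) ∷ _) ind (a∈ ∷ b∈ ∷ _) with clique a∈ b∈ a≢b
... | inj₁ adj = ⊥-elim (ind (here refl) (there (here refl)) adj)
... | inj₂ adj = ⊥-elim (ind (there (here refl)) (here refl) adj)

Balanced : Bool → List Cell → Set
Balanced c L = #colour (not c) L ≤ #colour c L × #colour c L ≤ suc (#colour (not c) L)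

balanced-∷ : ∀ z L → Balanced (not (colour z)) L → Balanced (colour z) (z ∷ L)
balanced-∷ z L (≤lead , lead≤)
  rewrite #colour-here z L | #colour-there z L | not-involutive (colour z) = lead≤ , s≤s ≤lead

-- Colours alternate along a row, so the colour of its last cell leads by zero or one.
bottomRow-balanced : ∀ r → Balanced (odd r) (bottomRow (suc r))
bottomRow-balanced zero    = z≤n , s≤s z≤n
bottomRow-balanced (suc r) = balanced-∷ (suc r , 0) (bottomRow (suc r))
  (subst (λ c → Balanced c (bottomRow (suc r))) (sym (not-involutive (odd r))) (bottomRow-balanced r))

staircase : ℕ → List ℕ
staircase zero    = []
staircase (suc j) = suc j ∷ staircase j

row-staircase : ∀ j y → row (staircase j) y ≡ j ∸ y
row-staircase zero    y       = sym (0∸n≡0 y)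
row-staircase (suc j) zero    = refl
row-staircase (suc j) (suc y) = row-staircase j y

staircase-majority : ∀ i → colourCount (not (odd i)) (staircase (suc i)) < colourCount (odd i) (staircase (suc i))
staircase-majority zero    = s≤s z≤n
staircase-majority (suc i) =
  subst₂ _<_ (sym (colourCount-∷ (not c) (suc (suc i)) S)) (sym (colourCount-∷ c (suc (suc i)) S))
    (+-mono-≤-< (proj₁ (bottomRow-balanced (suc i)))
      (subst₂ (λ a b → colourCount a S < colourCount b S) (sym (cong not involution)) (sym involution)
        (staircase-majority i)))
  where
  c : Bool
  c = odd (suc i)
  S : List ℕ
  S = staircase (suc i)
  involution : not (not (odd i)) ≡ odd i
  involution = not-involutive (odd i)

staircase-corner : ∀ i → cells (staircase (suc i)) ↭ (0 , i) ∷ cells (map suc (staircase i))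
staircase-corner zero    = ↭-refl
staircase-corner (suc i) = ↭-trans (++⁺ˡ (bottomRow (suc (suc i))) (map⁺ up (staircase-corner i)))
                                   (shift (0 , suc i) (bottomRow (suc (suc i))) _)

young-cornerless : ∀ i → Young (map suc (staircase i))
young-cornerless zero          = λ _ → z≤n
young-cornerless (suc zero)    = young-∷ z≤n (young-cornerless zero)
young-cornerless (suc (suc i)) = young-∷ (n≤1+n _) (young-cornerless (suc i))

-- One step of the peeling argument: the diagram loses a set of pairwise adjacent
-- cells (which holds at most one cell of an independent set) while its larger
-- colour class strictly shrinks.
record Peeling (l : List ℕ) : Set where
  field
    rest       : List ℕ
    rest-young : Young rest
    removed    : List Cell
    split      : cells l ↭ removed ++ cells rest
    clique     : ∀ {a b} → a ∈ removed → b ∈ removed → a ≢ b → Adjacent a b ⊎ Adjacent b a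
    shrinks    : majority rest < majority l

staircase-peeling : ∀ l i → (∀ y → row l y ≡ suc i ∸ y) → Peeling l
staircase-peeling l i rows = record
  { rest = R ; rest-young = young-cornerless i ; removed = (0 , i) ∷ []
  ; split = split
  ; clique = λ { (here refl) (here refl) a≢b → ⊥-elim (a≢b refl) }
  ; shrinks = shrinks }
  where
  R : List ℕ
  R = map suc (staircase i)
  c : Bool
  c = colour (0 , i)
  is-staircase : cells l ↭ cells (staircase (suc i))
  is-staircase = cells-rows l (staircase (suc i)) λ y → trans (rows y) (sym (row-staircase (suc i) y))
  split : cells l ↭ (0 , i) ∷ cells R
  split = ↭-trans is-staircase (staircase-corner i)
  gain : colourCount c l ≡ suc (colourCount c R)
  gain = trans (count-↭ _ split) (#colour-here (0 , i) (cells R))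
  same : colourCount (not c) l ≡ colourCount (not c) R
  same = trans (count-↭ _ split) (#colour-there (0 , i) (cells R))
  lead : colourCount (not c) l < colourCount c l
  lead = subst₂ _<_ (sym (count-↭ _ is-staircase)) (sym (count-↭ _ is-staircase))
    (subst (λ b → colourCount (not b) (staircase (suc i)) < colourCount b (staircase (suc i)))
      (cong odd (sym (+-identityʳ i))) (staircase-majority i))
  shrinks : majority R < majority l
  shrinks = begin-strict
    majority R              ≡⟨ majority-colour c R (≤-pred (subst₂ _<_ same gain lead)) ⟩
    colourCount c R         <⟨ n<1+n _ ⟩
    suc (colourCount c R)   ≡⟨ gain ⟨
    colourCount c l         ≤⟨ subst (colourCount c l ≤_) (sym (majority-by c l)) (m≤m⊔n _ _) ⟩
    majority l              ∎
    where open ≤-Reasoning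

record Domino (l : List ℕ) : Set where
  field
    rest       : List ℕ
    rest-young : Young rest
    c c'       : Cell
    adjacent   : Adjacent c c'
    split      : cells l ↭ c ∷ c' ∷ cells rest

-- Removing a domino lowers both colour classes by one.
domino-peeling : ∀ {l} → Domino l → Peeling l
domino-peeling {l} d = record
  { rest = rest ; rest-young = rest-young ; removed = c ∷ c' ∷ [] ; split = split
  ; clique = clique
  ; shrinks = ≤-reflexive (sym (cong₂ _⊔_ (drop false) (drop true))) }
  where
  open Domino d
  drop : ∀ b → colourCount b l ≡ suc (colourCount b rest)
  drop b = trans (count-↭ _ split) (#colour-pair b c c' (cells rest) (adjacent-colour c c' adjacent))
  clique : ∀ {a b} → a ∈ c ∷ c' ∷ [] → b ∈ c ∷ c' ∷ [] → a ≢ b → Adjacent a b ⊎ Adjacent b a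
  clique (here refl)         (there (here refl)) _   = inj₁ adjacent
  clique (there (here refl)) (here refl)         _   = inj₂ adjacent
  clique (here refl)         (here refl)         a≢b = ⊥-elim (a≢b refl)
  clique (there (here refl)) (there (here refl)) a≢b = ⊥-elim (a≢b refl)

domino-lift : ∀ r l → row l 0 ≤ r → Domino l → Domino (r ∷ l)
domino-lift r l l₀≤r d = record
  { rest = r ∷ rest
  ; rest-young = young-∷ (≤-trans (row-mono l rest inside 0) l₀≤r) rest-young
  ; c = up c ; c' = up c' ; adjacent = adjacent-up c c' adjacent
  ; split = ↭-trans (++⁺ˡ (bottomRow r) (map⁺ up split)) (shifts (bottomRow r) (up c ∷ up c' ∷ [])) }
  where
  open Domino d
  inside : ∀ {z} → z ∈ cells rest → z ∈ cells l
  inside z∈ = ∈-resp-↭ (↭-sym split) (there (there z∈))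

domino-horizontal : ∀ k l → row l 0 ≤ k → Young l → Domino (suc (suc k) ∷ l)
domino-horizontal k l l₀≤k young-l = record
  { rest = k ∷ l ; rest-young = young-∷ l₀≤k young-l
  ; c = k , 0 ; c' = suc k , 0 ; adjacent = inj₁ refl
  ; split = ↭-swap _ _ ↭-refl }

domino-vertical : ∀ i l → (∀ y → row l y ≡ i ∸ y) → Young l → Domino (suc i ∷ suc i ∷ l)
domino-vertical i l rows young-l = record
  { rest = i ∷ i ∷ l ; rest-young = young-∷ ≤-refl (young-∷ (≤-reflexive (rows 0)) young-l)
  ; c = i , 0 ; c' = i , 1 ; adjacent = inj₂ refl
  ; split = ↭-prep (i , 0) (shift (i , 1) (bottomRow i) _) }

Staircase : List ℕ → Set
Staircase l = ∃ λ j → ∀ y → row l y ≡ j ∸ y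

extend-staircase : ∀ j r l → (∀ y → row l y ≡ j ∸ y) → Young (r ∷ l) → Staircase (r ∷ l) ⊎ Domino (r ∷ l)
extend-staircase j r l rows young-rl with m≤n⇒m<n∨m≡n (subst (_≤ r) (rows 0) (young-rl 0))
... | inj₂ refl = same-length j l rows young-rl
  where
  same-length : ∀ j l → (∀ y → row l y ≡ j ∸ y) → Young (j ∷ l) → Staircase (j ∷ l) ⊎ Domino (j ∷ l)
  same-length zero    l        rows _     = inj₁ (0 , λ { zero → refl ; (suc y) → trans (rows y) (0∸n≡0 y) })
  same-length (suc i) []       rows _     = ⊥-elim (1+n≢0 (sym (rows 0)))
  same-length (suc i) (r' ∷ t) rows young with rows 0
  ... | refl = inj₂ (domino-vertical i t (rows ∘ suc) (young ∘ suc ∘ suc))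
... | inj₁ j<r with m≤n⇒m<n∨m≡n j<r
...   | inj₂ refl = inj₁ (suc j , λ { zero → refl ; (suc y) → rows y })
...   | inj₁ (s≤s (s≤s {n = k} j≤k)) =
  inj₂ (domino-horizontal k l (subst (_≤ k) (sym (rows 0)) j≤k) (young-rl ∘ suc))

staircase-or-domino : ∀ l → Young l → Staircase l ⊎ Domino l
staircase-or-domino []      _       = inj₁ (0 , λ y → sym (0∸n≡0 y))
staircase-or-domino (r ∷ l) young-rl with staircase-or-domino l (young-rl ∘ suc)
... | inj₂ d          = inj₂ (domino-lift r l (young-rl 0) d)
... | inj₁ (j , rows) = extend-staircase j r l rows young-rl

empty-or-peeling : ∀ l → Young l → (∀ z → ¬ l ∋ z) ⊎ Peeling l
empty-or-peeling l young-l with staircase-or-domino l young-l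
... | inj₁ (zero , rows)  = inj₁ λ (x , y) x< → n≮0 (subst (x <_) (trans (rows y) (0∸n≡0 y)) x<)
... | inj₁ (suc i , rows) = inj₂ (staircase-peeling l i rows)
... | inj₂ d              = inj₂ (domino-peeling d)

-- Induction on that class size: peel, and note that the peeled cells hold at most
-- one element of the set while the class shrinks by at least one.
independent≤majority : ∀ l → Young l → ∀ T → Unique T → All (l ∋_) T → Independent T → length T ≤ majority l
independent≤majority l = peel l (<-wellFounded (majority l))
  where
  peel : ∀ l → Acc _<_ (majority l) → Young l → ∀ T → Unique T → All (l ∋_) T → Independent T → length T ≤ majority l
  peel l (acc smaller) young-l T uT T⊆l indT with empty-or-peeling l young-l
  ... | inj₁ empty = subst (_≤ majority l) (sym (nothing-inside T⊆l)) z≤n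
    where
    nothing-inside : ∀ {T} → All (l ∋_) T → length T ≡ 0
    nothing-inside []        = refl
    nothing-inside (t∈ ∷ _) = ⊥-elim (empty _ t∈)
  ... | inj₂ P = begin
    length T                            ≡⟨ length-≡-count+count (rest ∋?_) T ⟩
    length inner + length outer         ≤⟨ +-mono-≤ inner-bound outer-bound ⟩
    majority rest + 1                   ≡⟨ +-comm (majority rest) 1 ⟩
    suc (majority rest)                 ≤⟨ shrinks ⟩
    majority l                          ∎
    where
    open Peeling P
    open ≤-Reasoning
    inner outer : List Cell
    inner = filter (rest ∋?_) T
    outer = filter (¬? ∘ (rest ∋?_)) T
    inner-bound : length inner ≤ majority rest
    inner-bound = peel rest (smaller shrinks) rest-young inner (Unique.filter⁺ (rest ∋?_) uT)
      (All.tabulate (proj₂ ∘ ∈-filter⁻ (rest ∋?_) {xs = T}))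
      (independent-⊆ (proj₁ ∘ ∈-filter⁻ (rest ∋?_) {xs = T}) indT)
    was-removed : ∀ {z} → z ∈ outer → z ∈ removed
    was-removed z∈ with ∈-filter⁻ (¬? ∘ (rest ∋?_)) {xs = T} z∈
    ... | z∈T , z∉rest with ∈-++⁻ removed (∈-resp-↭ split (∈-cells⁺ l (All.lookup T⊆l z∈T)))
    ...   | inj₁ z∈removed = z∈removed
    ...   | inj₂ z∈rest    = ⊥-elim (z∉rest (∈-cells⁻ rest z∈rest))
    outer-bound : length outer ≤ 1
    outer-bound = at-most-one removed outer clique (Unique.filter⁺ (¬? ∘ (rest ∋?_)) uT)
      (independent-⊆ (proj₁ ∘ ∈-filter⁻ (¬? ∘ (rest ∋?_)) {xs = T}) indT) (All.tabulate was-removed)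

exponent<power : ∀ {d} → 1 < d → ∀ x → x < d ^ x
exponent<power 1<d zero        = s≤s z≤n
exponent<power {d} 1<d (suc x) = ≤-<-trans (exponent<power 1<d x) (^-monoʳ-< d 1<d (n<1+n x))

indivisible⇒pos : ∀ {d a} → ¬ d ∣ a → 0 < a
indivisible⇒pos {a = zero}  d∤0 = ⊥-elim (d∤0 (divides 0 refl))
indivisible⇒pos {a = suc a} _   = z<s

divide-out : ∀ {d} → 1 < d → ∀ m → 0 < m → ∃ λ x → ∃ λ a → ¬ d ∣ a × m ≡ d ^ x * a
divide-out {d} 1<d = <-rec _ step
  where
  step : ∀ m → (∀ {k} → k < m → 0 < k → ∃ λ x → ∃ λ a → ¬ d ∣ a × k ≡ d ^ x * a) →
         0 < m → ∃ λ x → ∃ λ a → ¬ d ∣ a × m ≡ d ^ x * a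
  step m smaller 0<m with d ∣? m
  ... | no d∤m = 0 , m , d∤m , sym (+-identityʳ m)
  ... | yes (divides zero refl) = ⊥-elim (n≮0 0<m)
  ... | yes (divides (suc k) refl) with smaller (m<m*n (suc k) d 1<d) z<s
  ...   | x , a , d∤a , k≡ = suc x , a , d∤a , (begin
    suc k * d        ≡⟨ cong (_* d) k≡ ⟩
    d ^ x * a * d    ≡⟨ *-comm (d ^ x * a) d ⟩
    d * (d ^ x * a)  ≡⟨ *-assoc d (d ^ x) a ⟨
    d ^ suc x * a    ∎)
    where open ≡-Reasoning

∣-power-multiple : ∀ d x a → d ∣ d ^ suc x * a
∣-power-multiple d x a = divides (d ^ x * a) (trans (*-assoc d (d ^ x) a) (*-comm d (d ^ x * a)))

cancel-power : ∀ d .{{_ : NonZero d}} {x x' a a'} → ¬ d ∣ a → ¬ d ∣ a' →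
  d ^ x * a ≡ d ^ x' * a' → x ≡ x' × a ≡ a'
cancel-power d {zero}  {zero}   _   _    e = refl , trans (sym (*-identityˡ _)) (trans e (*-identityˡ _))
cancel-power d {suc x} {zero}   _   d∤a' e =
  ⊥-elim (d∤a' (subst (d ∣_) (trans e (*-identityˡ _)) (∣-power-multiple d x _)))
cancel-power d {zero}  {suc x'} d∤a _    e =
  ⊥-elim (d∤a (subst (d ∣_) (trans (sym e) (*-identityˡ _)) (∣-power-multiple d x' _)))
cancel-power d {suc x} {suc x'} d∤a d∤a' e
  with cancel-power d {x} {x'} d∤a d∤a' (*-cancelˡ-≡ _ _ d (trans (sym (*-assoc d (d ^ x) _)) (trans e (*-assoc d (d ^ x') _))))
... | refl , a≡a' = refl , a≡a'

run : {P : ℕ → Set} → ((n : ℕ) → Dec (P n)) → ℕ → ℕ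
run P? zero = 0
run P? (suc B) with P? 0
... | yes _ = suc (run (P? ∘ suc) B)
... | no _  = 0

run-sound : {P : ℕ → Set} (P? : (n : ℕ) → Dec (P n)) (B x : ℕ) → x < run P? B → P x
run-sound P? (suc B) x       x<run with P? 0
run-sound P? (suc B) zero    _     | yes p0 = p0
run-sound P? (suc B) (suc x) x<run | yes _  = run-sound (P? ∘ suc) B x (≤-pred x<run)
run-sound P? (suc B) x       ()    | no _

run-complete : {P : ℕ → Set} (P? : (n : ℕ) → Dec (P n)) (B : ℕ) → (∀ x → P (suc x) → P x) →
  (∀ x → P x → x < B) → ∀ x → P x → x < run P? B
run-complete P? zero    closed bounded x px = ⊥-elim (n≮0 (bounded x px))
run-complete {P} P? (suc B) closed bounded x px with P? 0
... | no ¬p0 = ⊥-elim (¬p0 (down x px))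
  where
  down : ∀ x → P x → P 0
  down zero    px = px
  down (suc x) px = down x (closed x px)
run-complete P? (suc B) closed bounded zero    px | yes _ = z<s
run-complete P? (suc B) closed bounded (suc x) px | yes _ =
  s≤s (run-complete (P? ∘ suc) B (closed ∘ suc) (λ x px → ≤-pred (bounded (suc x) px)) x px)

row-applyUpTo : ∀ f n y → y < n → row (applyUpTo f n) y ≡ f y
row-applyUpTo f (suc n) zero    _   = refl
row-applyUpTo f (suc n) (suc y) y<n = row-applyUpTo (f ∘ suc) n y (≤-pred y<n)

row-applyUpTo-beyond : ∀ f n y → n ≤ y → row (applyUpTo f n) y ≡ 0
row-applyUpTo-beyond f zero    y       _   = refl
row-applyUpTo-beyond f (suc n) (suc y) n≤y = row-applyUpTo-beyond (f ∘ suc) n y (≤-pred n≤y)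

*-≤⇒≤-/ : ∀ n .{{_ : NonZero n}} {s N} → n * s ≤ N → s ≤ N / n
*-≤⇒≤-/ n {s} {N} ns≤N = subst (_≤ N / n) (m*n/n≡m s n) (/-monoˡ-≤ n (subst (_≤ N) (*-comm n s) ns≤N))

≤-/⇒*-≤ : ∀ n .{{_ : NonZero n}} {s N} → s ≤ N / n → n * s ≤ N
≤-/⇒*-≤ n {s} {N} s≤N/n = ≤-trans (*-monoʳ-≤ n s≤N/n) (subst (_≤ N) (*-comm (N / n) n) (m/n*n≤m N n))

∈-range1⁻ : ∀ {N m} → m ∈ range1 N → 0 < m × m ≤ N
∈-range1⁻ m∈ with ∈-applyUpTo⁻ suc m∈
... | i , i<N , refl = z<s , i<N

∈-range1⁺ : ∀ {N m} → 0 < m → m ≤ N → m ∈ range1 N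
∈-range1⁺ {m = suc k} _ m≤N = ∈-applyUpTo⁺ suc m≤N

range1-unique : ∀ N → Unique (range1 N)
range1-unique N = Unique.applyUpTo⁺₁ suc N (λ i<j _ → <⇒≢ i<j ∘ suc-injective)

%2-odd : ∀ n → n % 2 ≡ (if odd n then 1 else 0)
%2-odd zero          = refl
%2-odd (suc zero)    = refl
%2-odd (suc (suc n)) = begin
  suc (suc n) % 2               ≡⟨ cong (_% 2) (+-comm 2 n) ⟩
  (n + 2) % 2                   ≡⟨ [m+n]%n≡m%n n 2 ⟩
  n % 2                         ≡⟨ %2-odd n ⟩
  (if odd n then 1 else 0)      ≡⟨ cong (λ b → if b then 1 else 0) (sym (not-involutive (odd n))) ⟩
  (if odd (suc (suc n)) then 1 else 0) ∎
  where open ≡-Reasoning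

same-parity : ∀ a b → a % 2 ≡ b % 2 → odd a ≡ odd b
same-parity a b e = indicator-injective (trans (sym (%2-odd a)) (trans e (%2-odd b)))
  where
  indicator-injective : ∀ {c c'} → (if c then 1 else 0) ≡ (if c' then 1 else 0) → c ≡ c'
  indicator-injective {false} {false} _ = refl
  indicator-injective {true}  {true}  _ = refl

same-parity⁻¹ : ∀ a b → odd a ≡ odd b → a % 2 ≡ b % 2
same-parity⁻¹ a b e = trans (%2-odd a) (trans (cong (λ c → if c then 1 else 0) e) (sym (%2-odd b)))

countᵇ-count : ∀ f xs → countᵇ f xs ≡ count (T? ∘ f) xs
countᵇ-count f [] = refl
countᵇ-count f (x ∷ xs) with f x
... | true  = cong suc (countᵇ-count f xs)
... | false = countᵇ-count f xs

module Smooth (p q : ℕ) (1<p : 1 < p) (1<q : 1 < q) (p⊥q : Coprime p q) where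

  instance
    p≢0 : NonZero p
    p≢0 = >-nonZero (<-trans z<s 1<p)
    q≢0 : NonZero q
    q≢0 = >-nonZero (<-trans z<s 1<q)

  smooth : Cell → ℕ
  smooth (x , y) = p ^ x * q ^ y

  smooth-pos : ∀ z → 0 < smooth z
  smooth-pos (x , y) = *-mono-≤ (m^n>0 p x) (m^n>0 q y)

  exponent<smooth : ∀ x y → x < smooth (x , y) × y < smooth (x , y)
  exponent<smooth x y =
      <-≤-trans (exponent<power 1<p x) (m≤m*n (p ^ x) (q ^ y) {{m^n≢0 q y}})
    , <-≤-trans (exponent<power 1<q y) (m≤n*m (q ^ y) (p ^ x) {{m^n≢0 p x}})

  scale-comm : ∀ a b c → a * (b * c) ≡ b * (a * c)
  scale-comm = solve-∀

  smooth-right : ∀ x y → smooth (suc x , y) ≡ p * smooth (x , y)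
  smooth-right x y = *-assoc p (p ^ x) (q ^ y)

  smooth-up : ∀ x y → smooth (x , suc y) ≡ q * smooth (x , y)
  smooth-up x y = scale-comm (p ^ x) q (q ^ y)

  p-step : ∀ n x y → p * (n * smooth (x , y)) ≡ n * smooth (suc x , y)
  p-step n x y = trans (scale-comm p n (smooth (x , y))) (cong (n *_) (sym (smooth-right x y)))

  q-step : ∀ n x y → q * (n * smooth (x , y)) ≡ n * smooth (x , suc y)
  q-step n x y = trans (scale-comm q n (smooth (x , y))) (cong (n *_) (sym (smooth-up x y)))

  PQFree : ℕ → Set
  PQFree n = ¬ p ∣ n × ¬ q ∣ n

  pq-free? : ∀ n → Dec (PQFree n)
  pq-free? n = ¬? (p ∣? n) ×-dec ¬? (q ∣? n)

  ¬∣-power : ∀ y n → ¬ p ∣ n → ¬ p ∣ q ^ y * n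
  ¬∣-power zero    n p∤n p∣ = p∤n (subst (p ∣_) (+-identityʳ n) p∣)
  ¬∣-power (suc y) n p∤n p∣ = ¬∣-power y n p∤n (coprime-divisor p⊥q (subst (p ∣_) (*-assoc q (q ^ y) n) p∣))

  factors-swap : ∀ n a b → n * (a * b) ≡ a * (b * n)
  factors-swap = solve-∀

  record Decomposition (m : ℕ) : Set where
    field
      core       : ℕ
      exps       : Cell
      core-free  : PQFree core
      factorised : m ≡ core * smooth exps

  decompose : ∀ m → 0 < m → Decomposition m
  decompose m 0<m with divide-out 1<p m 0<m
  ... | x , a , p∤a , m≡ with divide-out 1<q a (indivisible⇒pos p∤a)
  ...   | y , n , q∤n , a≡ =
    record { core = n ; exps = x , y ; core-free = p∤n , q∤n
           ; factorised = trans m≡ (trans (cong (p ^ x *_) a≡) (sym (factors-swap n (p ^ x) (q ^ y)))) }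
    where
    p∤n : ¬ p ∣ n
    p∤n p∣n = p∤a (subst (p ∣_) (sym a≡) (∣-trans p∣n (n∣m*n (q ^ y))))

  decomposition-unique : ∀ {n n' z z'} → PQFree n → PQFree n' → n * smooth z ≡ n' * smooth z' → n ≡ n' × z ≡ z'
  decomposition-unique {n} {n'} {x , y} {x' , y'} (p∤n , q∤n) (p∤n' , q∤n') e
    with cancel-power p {x} {x'} (¬∣-power y n p∤n) (¬∣-power y' n' p∤n')
           (trans (sym (factors-swap n (p ^ x) (q ^ y))) (trans e (factors-swap n' (p ^ x') (q ^ y'))))
  ... | refl , e′ with cancel-power q {y} {y'} q∤n q∤n' e′
  ...   | refl , refl = refl , refl

  free⇒pos : ∀ {n} → PQFree n → 0 < n
  free⇒pos (p∤n , _) = indivisible⇒pos p∤n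

  chain-pos : ∀ {n} z → PQFree n → 0 < n * smooth z
  chain-pos z free = *-mono-≤ (free⇒pos free) (smooth-pos z)

  -- The core (the part free of p and q) and the exponent pair of m; junk at m = 0.
  core : ℕ → ℕ
  core zero    = 0
  core (suc k) = Decomposition.core (decompose (suc k) z<s)

  exps : ℕ → Cell
  exps zero    = 0 , 0
  exps (suc k) = Decomposition.exps (decompose (suc k) z<s)

  core-free : ∀ {m} → 0 < m → PQFree (core m)
  core-free {suc k} _ = Decomposition.core-free (decompose (suc k) z<s)

  factorised : ∀ {m} → 0 < m → m ≡ core m * smooth (exps m)
  factorised {suc k} _ = Decomposition.factorised (decompose (suc k) z<s)

  core-exps : ∀ {m n} z → PQFree n → m ≡ n * smooth z → core m ≡ n × exps m ≡ z
  core-exps {m} z free m≡ = decomposition-unique (core-free 0<m) free (trans (sym (factorised 0<m)) m≡)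
    where
    0<m : 0 < m
    0<m = subst (0 <_) (sym m≡) (chain-pos z free)

  core≤ : ∀ {m} → 0 < m → core m ≤ m
  core≤ {m} 0<m = subst (core m ≤_) (sym (factorised 0<m)) (m≤m*n (core m) (smooth (exps m)) {{>-nonZero (smooth-pos (exps m))}})

  exps-injective : ∀ {m m'} → 0 < m → 0 < m' → core m ≡ core m' → exps m ≡ exps m' → m ≡ m'
  exps-injective 0<m 0<m' same-core same-exps =
    trans (factorised 0<m) (trans (cong₂ (λ n z → n * smooth z) same-core same-exps) (sym (factorised 0<m')))

  multiple⇒adjacent : ∀ {m m'} → 0 < m → m' ≡ p * m ⊎ m' ≡ q * m → core m' ≡ core m × Adjacent (exps m) (exps m')
  multiple⇒adjacent {m} 0<m (inj₁ refl) =
    map₂ inj₁ (core-exps _ (core-free 0<m) (trans (cong (p *_) (factorised 0<m)) (p-step (core m) x y)))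
    where
    x y : ℕ
    x = proj₁ (exps m)
    y = proj₂ (exps m)
  multiple⇒adjacent {m} 0<m (inj₂ refl) =
    map₂ inj₂ (core-exps _ (core-free 0<m) (trans (cong (q *_) (factorised 0<m)) (q-step (core m) x y)))
    where
    x y : ℕ
    x = proj₁ (exps m)
    y = proj₂ (exps m)

  adjacent⇒multiple : ∀ {m m'} → 0 < m → 0 < m' → core m ≡ core m' → Adjacent (exps m) (exps m') →
    m' ≡ p * m ⊎ m' ≡ q * m
  adjacent⇒multiple {m} {m'} 0<m 0<m' same-core (inj₁ right) = inj₁ (begin
    m'                               ≡⟨ factorised 0<m' ⟩
    core m' * smooth (exps m')       ≡⟨ cong₂ (λ n z → n * smooth z) (sym same-core) right ⟩
    core m * smooth (suc x , y)      ≡⟨ p-step (core m) x y ⟨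
    p * (core m * smooth (x , y))    ≡⟨ cong (p *_) (factorised 0<m) ⟨
    p * m                            ∎)
    where
    open ≡-Reasoning
    x y : ℕ
    x = proj₁ (exps m)
    y = proj₂ (exps m)
  adjacent⇒multiple {m} {m'} 0<m 0<m' same-core (inj₂ above) = inj₂ (begin
    m'                               ≡⟨ factorised 0<m' ⟩
    core m' * smooth (exps m')       ≡⟨ cong₂ (λ n z → n * smooth z) (sym same-core) above ⟩
    core m * smooth (x , suc y)      ≡⟨ q-step (core m) x y ⟨
    q * (core m * smooth (x , y))    ≡⟨ cong (q *_) (factorised 0<m) ⟨
    q * m                            ∎)
    where
    open ≡-Reasoning
    x y : ℕ
    x = proj₁ (exps m)
    y = proj₂ (exps m)

  -- Its row y has the x with p ^ x q ^ y ≤ u, an initial segment of x < u + 1.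
  rowLength : ℕ → ℕ → ℕ
  rowLength u y = run (λ x → smooth (x , y) ≤? u) (suc u)

  smoothDiagram : ℕ → List ℕ
  smoothDiagram u = applyUpTo (rowLength u) (suc u)

  ∈-smoothDiagram⁺ : ∀ {u} z → smooth z ≤ u → smoothDiagram u ∋ z
  ∈-smoothDiagram⁺ {u} (x , y) z≤u =
    subst (x <_) (sym (row-applyUpTo (rowLength u) (suc u) y (s≤s (<⇒≤ (<-≤-trans (proj₂ (exponent<smooth x y)) z≤u)))))
      (run-complete (λ x → smooth (x , y) ≤? u) (suc u)
        (λ x sx≤u → ≤-trans (m≤n*m (smooth (x , y)) p) (subst (_≤ u) (smooth-right x y) sx≤u))
        (λ x x≤u → s≤s (<⇒≤ (<-≤-trans (proj₁ (exponent<smooth x y)) x≤u))) x z≤u)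

  ∈-smoothDiagram⁻ : ∀ {u} z → smoothDiagram u ∋ z → smooth z ≤ u
  ∈-smoothDiagram⁻ {u} (x , y) x<row with y <? suc u
  ... | yes y≤u = run-sound (λ x → smooth (x , y) ≤? u) (suc u) x
                    (subst (x <_) (row-applyUpTo (rowLength u) (suc u) y y≤u) x<row)
  ... | no y≰u  = ⊥-elim (n≮0 (subst (x <_) (row-applyUpTo-beyond (rowLength u) (suc u) y (≮⇒≥ y≰u)) x<row))

  smoothDiagram-young : ∀ u → Young (smoothDiagram u)
  smoothDiagram-young u y = ≤-from-below _ _ λ x x<row →
    ∈-smoothDiagram⁺ (x , y) (≤-trans (m≤n*m (smooth (x , y)) q) (subst (_≤ u) (smooth-up x y) (∈-smoothDiagram⁻ (x , suc y) x<row)))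

  inAᵇ-sound : ∀ j m → T (inAᵇ p q j m) → ∃ λ z → m ≡ smooth z × colour z ≡ odd j
  inAᵇ-sound j m found with find (any⁻ _ (upTo (suc m)) found)
  ... | x , _ , found-y with find (any⁻ _ (upTo (suc m)) found-y)
  ...   | y , _ , both with Equivalence.to T-∧ both
  ...     | is-m , parity = (x , y) , sym (≡ᵇ⇒≡ _ _ is-m) ,
                             trans (cong odd (+-comm y x)) (same-parity (x + y) j (≡ᵇ⇒≡ _ _ parity))

  inAᵇ-complete : ∀ j z → colour z ≡ odd j → T (inAᵇ p q j (smooth z))
  inAᵇ-complete j (x , y) colour≡ =
    any⁺ _ (lose (∈-upTo⁺ (s≤s (<⇒≤ (proj₁ (exponent<smooth x y)))))
      (any⁺ _ (lose (∈-upTo⁺ (s≤s (<⇒≤ (proj₂ (exponent<smooth x y)))))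
        (Equivalence.from T-∧ (≡⇒≡ᵇ (smooth (x , y)) (smooth (x , y)) refl ,
          ≡⇒≡ᵇ ((x + y) % 2) (j % 2) (same-parity⁻¹ (x + y) j (trans (cong odd (+-comm x y)) colour≡)))))))

  one-free : PQFree 1
  one-free = (λ p∣1 → <⇒≢ 1<p (sym (∣1⇒≡1 p∣1))) , (λ q∣1 → <⇒≢ 1<q (sym (∣1⇒≡1 q∣1)))

  core-exps-smooth : ∀ z → core (smooth z) ≡ 1 × exps (smooth z) ≡ z
  core-exps-smooth z = core-exps z one-free (sym (*-identityˡ (smooth z)))

  countA≡colourCount : ∀ j u → countᵇ (inAᵇ p q j) (range1 u) ≡ colourCount (odd j) (smoothDiagram u)
  countA≡colourCount j u = trans (countᵇ-count (inAᵇ p q j) (range1 u))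
    (count-bijection (T? ∘ inAᵇ p q j) (λ z → colour z ≟ᵇ odd j) exps
      (range1-unique u) (cells-unique (smoothDiagram u)) maps-to injective onto)
    where
    maps-to : ∀ {m} → m ∈ range1 u → T (inAᵇ p q j m) → exps m ∈ cells (smoothDiagram u) × colour (exps m) ≡ odd j
    maps-to {m} m∈ found with inAᵇ-sound j m found
    ... | z , refl , colour≡ rewrite proj₂ (core-exps-smooth z) =
      ∈-cells⁺ (smoothDiagram u) (∈-smoothDiagram⁺ z (proj₂ (∈-range1⁻ m∈))) , colour≡
    core-one : ∀ {m} → T (inAᵇ p q j m) → core m ≡ 1
    core-one {m} found with inAᵇ-sound j m found
    ... | z , refl , _ = proj₁ (core-exps-smooth z)
    injective : ∀ {m m'} → m ∈ range1 u → m' ∈ range1 u → T (inAᵇ p q j m) → T (inAᵇ p q j m') → exps m ≡ exps m' → m ≡ m'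
    injective {m} {m'} m∈ m'∈ found found' = exps-injective (proj₁ (∈-range1⁻ m∈)) (proj₁ (∈-range1⁻ m'∈))
      (trans (core-one {m} found) (sym (core-one {m'} found')))
    onto : ∀ {z} → z ∈ cells (smoothDiagram u) → colour z ≡ odd j → ∃ λ m → m ∈ range1 u × T (inAᵇ p q j m) × exps m ≡ z
    onto {z} z∈ colour≡ = smooth z
      , ∈-range1⁺ (smooth-pos z) (∈-smoothDiagram⁻ z (∈-cells⁻ _ z∈))
      , inAᵇ-complete j z colour≡
      , proj₂ (core-exps-smooth z)

  chainDiagram : ℕ → ℕ → List ℕ
  chainDiagram N zero    = []
  chainDiagram N (suc k) = smoothDiagram (N / suc k)

  chainDiagram-young : ∀ N n → Young (chainDiagram N n)
  chainDiagram-young N zero    = λ _ → z≤n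
  chainDiagram-young N (suc k) = smoothDiagram-young (N / suc k)

  ∈-chainDiagram⁺ : ∀ {N n} z → PQFree n → n * smooth z ≤ N → chainDiagram N n ∋ z
  ∈-chainDiagram⁺ {n = zero}  z free _   = ⊥-elim (n≮0 (free⇒pos free))
  ∈-chainDiagram⁺ {n = suc k} z _    ≤N = ∈-smoothDiagram⁺ z (*-≤⇒≤-/ (suc k) ≤N)

  ∈-chainDiagram⁻ : ∀ {N n} z → chainDiagram N n ∋ z → n * smooth z ≤ N
  ∈-chainDiagram⁻ {n = suc k} z z∈ = ≤-/⇒*-≤ (suc k) (∈-smoothDiagram⁻ z z∈)

  exps∈chainDiagram : ∀ {N m} → m ∈ range1 N → chainDiagram N (core m) ∋ exps m
  exps∈chainDiagram {N} {m} m∈ with ∈-range1⁻ m∈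
  ... | 0<m , m≤N = ∈-chainDiagram⁺ (exps m) (core-free 0<m) (subst (_≤ N) (factorised 0<m) m≤N)

  core∈range1 : ∀ {N m} → m ∈ range1 N → core m ∈ range1 N
  core∈range1 m∈ with ∈-range1⁻ m∈
  ... | 0<m , m≤N = ∈-range1⁺ (free⇒pos (core-free 0<m)) (≤-trans (core≤ 0<m) m≤N)

  summand-free : ∀ N n → PQFree n → summand p q N n ≡ majority (chainDiagram N n)
  summand-free N zero    free = ⊥-elim (n≮0 (free⇒pos free))
  summand-free N (suc k) (p∤n , q∤n) with p ∣? suc k | q ∣? suc k
  ... | yes p∣n | _       = ⊥-elim (p∤n p∣n)
  ... | no _    | yes q∣n = ⊥-elim (q∤n q∣n)
  ... | no _    | no _    = cong₂ _⊔_ (countA≡colourCount 0 (N / suc k)) (countA≡colourCount 1 (N / suc k))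

  summand-nonfree : ∀ N n → ¬ PQFree n → summand p q N n ≡ 0
  summand-nonfree N n ¬free with p ∣? n | q ∣? n
  ... | yes _ | _     = refl
  ... | no _  | yes _ = refl
  ... | no p∤n | no q∤n = ⊥-elim (¬free (p∤n , q∤n))

  fibre : ℕ → List ℕ → List ℕ
  fibre n = filter (λ m → core m ≟ n)

  -- Upper bound on each fibre: its exponent pairs form an independent set of the
  -- chain diagram, since adjacent pairs would be related by a factor p or q.
  fibre-bound : ∀ N S n → AdmissibleSubset p q N S → length (fibre n S) ≤ majority (chainDiagram N n)
  fibre-bound N S n (uS , S⊆ , quotient-free) =
    subst (_≤ majority (chainDiagram N n)) (length-map exps (fibre n S))
      (independent≤majority (chainDiagram N n) (chainDiagram-young N n) (map exps (fibre n S))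
        (unique-map-on exps injective (Unique.filter⁺ _ uS)) inside independent)
    where
    member : ∀ {m} → m ∈ fibre n S → m ∈ S × core m ≡ n
    member = ∈-filter⁻ (λ m → core m ≟ n) {xs = S}
    pos : ∀ {m} → m ∈ fibre n S → 0 < m
    pos m∈ = proj₁ (All.lookup S⊆ (proj₁ (member m∈)))
    same-core : ∀ {m m'} → m ∈ fibre n S → m' ∈ fibre n S → core m ≡ core m'
    same-core m∈ m'∈ = trans (proj₂ (member m∈)) (sym (proj₂ (member m'∈)))
    injective : ∀ {m m'} → m ∈ fibre n S → m' ∈ fibre n S → exps m ≡ exps m' → m ≡ m'
    injective m∈ m'∈ = exps-injective (pos m∈) (pos m'∈) (same-core m∈ m'∈)
    inside : All (chainDiagram N n ∋_) (map exps (fibre n S))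
    inside = All.tabulate in-diagram
      where
      in-diagram : ∀ {z} → z ∈ map exps (fibre n S) → chainDiagram N n ∋ z
      in-diagram z∈ with ∈-map⁻ exps z∈
      ... | m , m∈ , refl with member m∈
      ...   | m∈S , refl = exps∈chainDiagram (∈-range1⁺ (pos m∈) (proj₂ (All.lookup S⊆ m∈S)))
    independent : Independent (map exps (fibre n S))
    independent a∈ b∈ adjacent with ∈-map⁻ exps a∈ | ∈-map⁻ exps b∈
    ... | m , m∈ , refl | m' , m'∈ , refl
      with adjacent⇒multiple (pos m∈) (pos m'∈) (same-core m∈ m'∈) adjacent
    ...   | inj₁ m'≡pm = proj₁ (quotient-free (proj₁ (member m'∈)) (proj₁ (member m∈))) m'≡pm
    ...   | inj₂ m'≡qm = proj₂ (quotient-free (proj₁ (member m'∈)) (proj₁ (member m∈))) m'≡qm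

  fibre-nonfree : ∀ n S → All (λ m → 0 < m) S → ¬ PQFree n → length (fibre n S) ≡ 0
  fibre-nonfree n S S-pos ¬free = cong length (filter-none (λ m → core m ≟ n)
    (All.map (λ 0<m core≡n → ¬free (subst PQFree core≡n (core-free 0<m))) S-pos))

  length≡sum-fibres : ∀ N S → All (λ m → m ∈ range1 N) S → length S ≡ sum (map (λ n → length (fibre n S)) (range1 N))
  length≡sum-fibres N S S⊆ = sym (sum-fibres core (range1-unique N) S (All.map core∈range1 S⊆))

  upper-bound : ∀ N S → AdmissibleSubset p q N S → length S ≤ formula p q N
  upper-bound N S adm@(_ , S⊆ , _) = begin
    length S                                            ≡⟨ length≡sum-fibres N S (All.map (λ (0<m , m≤N) → ∈-range1⁺ 0<m m≤N) S⊆) ⟩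
    sum (map (λ n → length (fibre n S)) (range1 N))     ≤⟨ sum-mono _ _ (range1 N) bound ⟩
    sum (map (summand p q N) (range1 N))                ∎
    where
    open ≤-Reasoning
    bound : ∀ {n} → n ∈ range1 N → length (fibre n S) ≤ summand p q N n
    bound {n} _ with pq-free? n
    ... | yes free = subst (length (fibre n S) ≤_) (sym (summand-free N n free)) (fibre-bound N S n adm)
    ... | no ¬free = ≤-reflexive (trans (fibre-nonfree n S (All.map proj₁ S⊆) ¬free) (sym (summand-nonfree N n ¬free)))

  -- The extremal set: in every chain keep the exponent pairs of the majority colour.
  extremal : ℕ → List ℕ
  extremal N = filter (λ m → colour (exps m) ≟ᵇ majorityColour (chainDiagram N (core m))) (range1 N)

  ∈-extremal⁻ : ∀ N {m} → m ∈ extremal N → m ∈ range1 N × colour (exps m) ≡ majorityColour (chainDiagram N (core m))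
  ∈-extremal⁻ N = ∈-filter⁻ _ {xs = range1 N}

  extremal-admissible : ∀ N → AdmissibleSubset p q N (extremal N)
  extremal-admissible N = Unique.filter⁺ _ (range1-unique N) , All.tabulate (∈-range1⁻ ∘ proj₁ ∘ ∈-extremal⁻ N) , quotient-free
    where
    -- m' = p m or q m would put two cells of opposite colours into the same chain.
    not-multiple : ∀ {m m'} → m ∈ extremal N → m' ∈ extremal N → m' ≡ p * m ⊎ m' ≡ q * m → ⊥
    not-multiple m∈ m'∈ multiple with multiple⇒adjacent (proj₁ (∈-range1⁻ (proj₁ (∈-extremal⁻ N m∈)))) multiple
    ... | same-core , adjacent =
      not-¬ (trans (proj₂ (∈-extremal⁻ N m'∈)) (trans (cong (majorityColour ∘ chainDiagram N) same-core) (sym (proj₂ (∈-extremal⁻ N m∈)))))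
            (adjacent-colour _ _ adjacent)
    quotient-free : QuotientFree p q (extremal N)
    quotient-free x∈ y∈ = (λ x≡py → not-multiple y∈ x∈ (inj₁ x≡py)) , (λ x≡qy → not-multiple y∈ x∈ (inj₂ x≡qy))

  extremal-fibre : ∀ N n → PQFree n → length (fibre n (extremal N)) ≡ majority (chainDiagram N n)
  extremal-fibre N n free = trans
    (count-bijection (λ m → core m ≟ n) (λ z → colour z ≟ᵇ majorityColour D) exps
      (Unique.filter⁺ _ (range1-unique N)) (cells-unique D) maps-to injective onto)
    (majorityColour-count D)
    where
    D : List ℕ
    D = chainDiagram N n
    maps-to : ∀ {m} → m ∈ extremal N → core m ≡ n → exps m ∈ cells D × colour (exps m) ≡ majorityColour D
    maps-to m∈ refl = ∈-cells⁺ D (exps∈chainDiagram (proj₁ (∈-extremal⁻ N m∈))) , proj₂ (∈-extremal⁻ N m∈)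
    pos : ∀ {m} → m ∈ extremal N → 0 < m
    pos = proj₁ ∘ ∈-range1⁻ ∘ proj₁ ∘ ∈-extremal⁻ N
    injective : ∀ {m m'} → m ∈ extremal N → m' ∈ extremal N → core m ≡ n → core m' ≡ n → exps m ≡ exps m' → m ≡ m'
    injective m∈ m'∈ core≡ core≡' = exps-injective (pos m∈) (pos m'∈) (trans core≡ (sym core≡'))
    onto : ∀ {z} → z ∈ cells D → colour z ≡ majorityColour D → ∃ λ m → m ∈ extremal N × core m ≡ n × exps m ≡ z
    onto {z} z∈ colour≡ with core-exps {n * smooth z} z free refl
    ... | core≡ , exps≡ = n * smooth z
      , ∈-filter⁺ (λ m → colour (exps m) ≟ᵇ majorityColour (chainDiagram N (core m)))
          (∈-range1⁺ (chain-pos z free) (∈-chainDiagram⁻ {N} {n} z (∈-cells⁻ D z∈)))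
          (trans (cong colour exps≡) (trans colour≡ (cong (majorityColour ∘ chainDiagram N) (sym core≡))))
      , core≡ , exps≡

  extremal-size : ∀ N → length (extremal N) ≡ formula p q N
  extremal-size N = begin
    length (extremal N)                                          ≡⟨ length≡sum-fibres N (extremal N) (All.tabulate (proj₁ ∘ ∈-extremal⁻ N)) ⟩
    sum (map (λ n → length (fibre n (extremal N))) (range1 N))   ≡⟨ sum-cong _ _ (range1 N) size ⟩
    sum (map (summand p q N) (range1 N))                         ∎
    where
    open ≡-Reasoning
    size : ∀ {n} → n ∈ range1 N → length (fibre n (extremal N)) ≡ summand p q N n
    size {n} _ with pq-free? n
    ... | yes free = trans (extremal-fibre N n free) (sym (summand-free N n free))
    ... | no ¬free = trans (fibre-nonfree n (extremal N) (All.map proj₁ (proj₁ (proj₂ (extremal-admissible N)))) ¬free)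
                           (sym (summand-nonfree N n ¬free))

corollary3 : (p q N : ℕ) → 1 < p → p < q → gcd p q ≡ 1 →
    IsMaxQFCard p q N (formula p q N)
corollary3 p q N 1<p p<q gcd≡1 =
  (extremal N , extremal-admissible N , extremal-size N) , upper-bound N
  where open Smooth p q 1<p (<-trans 1<p p<q) (gcd≡1⇒coprime gcd≡1)
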